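{- Let $(\mathbb{A},D)$ be an ultra-designated $\mathsf{Cobounded}$-algebra, let $\varphi,\psi$ be formulas of $\mathcal{L}_\in$ with free variables among $x_1,x_2,\dots$, and let $\vec{[u]}=([u_1],[u_2],\dots)$ be a sequence of elements of $\mathbf{V}^{(\mathbb{A})}/\!\sim$. Then: (i) $\mathbf{V}^{(\mathbb{A})}/\!\sim\ \models(\varphi\to\psi)(\vec{[u]})$ iff $\mathbf{V}^{(\mathbb{A})}/\!\sim\ \not\models\varphi(\vec{[u]})$ or $\mathbf{V}^{(\mathbb{A})}/\!\sim\ \models\psi(\vec{[u]})$; (ii) $\mathbf{V}^{(\mathbb{A})}/\!\sim\ \models(\varphi\wedge\psi)(\vec{[u]})$ iff $\mathbf{V}^{(\mathbb{A})}/\!\sim\ \models\varphi(\vec{[u]})$ and $\mathbf{V}^{(\mathbb{A})}/\!\sim\ \models\psi(\vec{[u]})$; (iii) $\mathbf{V}^{(\mathbb{A})}/\!\sim\ \models(\varphi\vee\psi)(\vec{[u]})$ iff $\mathbf{V}^{(\mathbb{A})}/\!\sim\ \models\varphi(\vec{[u]})$ or $\mathbf{V}^{(\mathbb{A})}/\!\sim\ \models\psi(\vec{[u]})$; (iv) if $\mathbf{V}^{(\mathbb{A})}/\!\sim\ \not\models\varphi(\vec{[u]})$ then $\mathbf{V}^{(\mathbb{A})}/\!\sim\ \models\neg\varphi(\vec{[u]})$; (v) $\mathbf{V}^{(\mathbb{A})}/\!\sim\ \models(\forall x_k\varphi)(\vec{[u]})$ iff $\mathbf{V}^{(\mathbb{A})}/\!\sim\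 \models\varphi(\vec{[u]}(d/k))$ for all $d\in\mathbf{V}^{(\mathbb{A})}/\!\sim$, where $\vec{[u]}(d/k)=([u_1],\dots,[u_{k-1}],d,[u_{k+1}],\dots)$; (vi) $\mathbf{V}^{(\mathbb{A})}/\!\sim\ \models(\exists x_k\varphi)(\vec{[u]})$ iff $\mathbf{V}^{(\mathbb{A})}/\!\sim\ \models\varphi(\vec{[u]}(d/k))$ for some $d\in\mathbf{V}^{(\mathbb{A})}/\!\sim$.
   Context: A designated set is a lattice filter $D$ with $\mathbf{1}\in D$, $\mathbf{0}\notin D$. A $\mathsf{Cobounded}$-algebra is $\langle\mathbf{A},\wedge,\vee,\Rightarrow,\mathbf{1},\mathbf{0}\rangle$ with complete distributive lattice reduct, such that $\bigvee_i a_i=\mathbf{1}$ implies some $a_j=\mathbf{1}$, $\bigwedge_i a_i=\mathbf{0}$ implies some $a_j=\mathbf{0}$, and $a\Rightarrow b=\mathbf{0}$ if $a\ne\mathbf{0},b=\mathbf{0}$, else $\mathbf{1}$. A designated $\mathsf{Cobounded}$-algebra $(\mathbb{A},D)$ adds ${}^*$: $a^*=\mathbf{0}$ if $a=\mathbf{1}$, $a^*=a$ if $a\in D\setminus\{\mathbf{1}\}$, $a^*=\mathbf{1}$ if $a\notin D$; ultra-designated if $D$ is an ultrafilter. $\mathbf{V}^{(\mathbb{A})}$ = class of $\mathbf{A}$-valued functions defined by recursion ($\mathbf{V}^{(\mathbb{A})}_\alpha$ = functions with range in $\mathbf{A}$ and domain $\subseteq\mathbf{V}^{(\mathbb{A})}_\xi$,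 $\xi<\alpha$). $\llbracket\cdot\rrbracket$ denotes $\llbracket\cdot\rrbracket_{\mathrm{PA}}$: $\llbracket u\in v\rrbracket=\bigvee_{x\in\mathrm{dom}(v)}(v(x)\wedge\llbracket x=u\rrbracket)$, $\llbracket u=v\rrbracket=\bigwedge_{x\in\mathrm{dom}(u)}((u(x)\Rightarrow\llbracket x\in v\rrbracket)\wedge(\llbracket x\in v\rrbracket^*\Rightarrow u(x)^*))\wedge\bigwedge_{y\in\mathrm{dom}(v)}((v(y)\Rightarrow\llbracket y\in u\rrbracket)\wedge(\llbracket y\in u\rrbracket^*\Rightarrow v(y)^*))$, extended homomorphically (connectives to $\wedge,\vee,\Rightarrow,{}^*$, quantifiers to $\bigwedge,\bigvee$ over $\mathbf{V}^{(\mathbb{A})}$). $\mathbf{V}^{(\mathbb{A})}\models\varphi$ iff $\llbracket\varphi\rrbracket\in D$. $u\sim v$ iff $\mathbf{V}^{(\mathbb{A})}\models u=v$; $[u]$ is the class of $u$. For a formula $\varphi$ of $\mathcal{L}_\in$ and a sequence $\vec{[u]}$, $\mathbf{V}^{(\mathbb{A})}/\!\sim\ \models\varphi(\vec{[u]})$ iff $\mathbf{V}^{(\mathbb{A})}\models\varphi(\vec{u})$ (the free variables $x_i$ replaced by the constants $u_i$). -}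

module Defs where

open import Level using (Level; _⊔_; Lift; lift; lower) renaming (suc to lsuc)
open import Data.Nat using (ℕ; _≟_)
open import Data.Product using (_×_; ∃)
open import Relation.Binary.PropositionalEquality using (_≡_; _≢_)
open import Relation.Nullary using (¬_; yes; no)

record CoboundedAlgebra (c ι : Level) : Set (lsuc (c ⊔ ι)) where
  infixr 7 _∧_
  infixr 6 _∨_
  infixr 5 _⇒_
  infix  4 _≤_
  field
    Carrier : Set c
    _≤_     : Carrier → Carrier → Set c
    ≤-refl    : ∀ {x} → x ≤ x
    ≤-trans   : ∀ {x y z} → x ≤ y → y ≤ z → x ≤ z
    ≤-antisym : ∀ {x y} → x ≤ y → y ≤ x → x ≡ y

    _∧_ _∨_ _⇒_ : Carrier → Carrier → Carrier
    𝟏 𝟎 : Carrier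
    ⋀ ⋁ : {I : Set ι} → (I → Carrier) → Carrier

    ∧-lb₁ : ∀ x y → x ∧ y ≤ x
    ∧-lb₂ : ∀ x y → x ∧ y ≤ y
    ∧-glb : ∀ {x y z} → z ≤ x → z ≤ y → z ≤ x ∧ y
    ∨-ub₁ : ∀ x y → x ≤ x ∨ y
    ∨-ub₂ : ∀ x y → y ≤ x ∨ y
    ∨-lub : ∀ {x y z} → x ≤ z → y ≤ z → x ∨ y ≤ z

    ⋀-lb  : ∀ {I : Set ι} (f : I → Carrier) (i : I) → ⋀ f ≤ f i
    ⋀-glb : ∀ {I : Set ι} (f : I → Carrier) {z} → (∀ i → z ≤ f i) → z ≤ ⋀ f
    ⋁-ub  : ∀ {I : Set ι} (f : I → Carrier) (i : I) → f i ≤ ⋁ f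
    ⋁-lub : ∀ {I : Set ι} (f : I → Carrier) {z} → (∀ i → f i ≤ z) → ⋁ f ≤ z

    𝟏-top : ∀ x → x ≤ 𝟏
    𝟎-bot : ∀ x → 𝟎 ≤ x

    distrib : ∀ x y z → x ∧ (y ∨ z) ≡ (x ∧ y) ∨ (x ∧ z)

    ⋁-cobounded : ∀ {I : Set ι} (f : I → Carrier) → ⋁ f ≡ 𝟏 → ∃ λ j → f j ≡ 𝟏
    ⋀-cobounded : ∀ {I : Set ι} (f : I → Carrier) → ⋀ f ≡ 𝟎 → ∃ λ j → f j ≡ 𝟎

    ⇒-𝟎 : ∀ a b → a ≢ 𝟎 → b ≡ 𝟎 → a ⇒ b ≡ 𝟎
    ⇒-𝟏 : ∀ a b → ¬ (a ≢ 𝟎 × b ≡ 𝟎) → a ⇒ b ≡ 𝟏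

record DesignatedAlgebra (c ι d : Level) : Set (lsuc (c ⊔ ι ⊔ d)) where
  infix 8 _*
  field
    algebra : CoboundedAlgebra c ι
  open CoboundedAlgebra algebra public
  field
    D : Carrier → Set d
    D-𝟏   : D 𝟏
    D-𝟎   : ¬ D 𝟎
    D-up  : ∀ {x y} → x ≤ y → D x → D y
    D-∧   : ∀ {x y} → D x → D y → D (x ∧ y)

    _* : Carrier → Carrier
    *-𝟏  : ∀ a → a ≡ 𝟏 → a * ≡ 𝟎
    *-D  : ∀ a → D a → a ≢ 𝟏 → a * ≡ a
    *-¬D : ∀ a → ¬ D a → a * ≡ 𝟏

  record IsProperFilter (F : Carrier → Set d) : Set (c ⊔ d) where
    field
      F-𝟏  : F 𝟏
      F-𝟎  : ¬ F 𝟎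
      F-up : ∀ {x y} → x ≤ y → F x → F y
      F-∧  : ∀ {x y} → F x → F y → F (x ∧ y)

  IsUltra : Set (lsuc d ⊔ c)
  IsUltra = ∀ (F : Carrier → Set d) → IsProperFilter F →
            (∀ a → D a → F a) → ∀ a → F a → D a

-- Names: the A-valued universe V^(A), rendered as well-founded trees.

data Name {c} (A : Set c) (ℓ : Level) : Set (c ⊔ lsuc ℓ) where
  mk : (I : Set ℓ) → (I → Name A ℓ) → (I → A) → Name A ℓ

data Formula : Set where
  _∈'_ _≐'_      : ℕ → ℕ → Formula
  _⇒'_ _∧'_ _∨'_ : Formula → Formula → Formula
  ¬'_            : Formula → Formula
  ∀'_·_ ∃'_·_    : ℕ → Formula → Formula

module Semantics {c d ℓ : Level} (𝔸 : DesignatedAlgebra c (c ⊔ lsuc ℓ) d) where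
  open DesignatedAlgebra 𝔸

  V : Set (c ⊔ lsuc ℓ)
  V = Name Carrier ℓ

  mutual
    ⟦_∈_⟧ : V → V → Carrier
    ⟦ u ∈ mk I f g ⟧ = ⋁ {Lift (c ⊔ lsuc ℓ) I} λ i → g (lower i) ∧ ⟦ f (lower i) ≐ u ⟧

    ⟦_≐_⟧ : V → V → Carrier
    ⟦ u@(mk I f g) ≐ v@(mk J h k) ⟧ =
        ⋀ {Lift (c ⊔ lsuc ℓ) I} (λ i → (g (lower i) ⇒ ⟦ f (lower i) ∈ v ⟧)
                          ∧ ((⟦ f (lower i) ∈ v ⟧ *) ⇒ (g (lower i) *)))
      ∧ ⋀ {Lift (c ⊔ lsuc ℓ) J} (λ j → (k (lower j) ⇒ ⟦ h (lower j) ∈ u ⟧)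
                          ∧ ((⟦ h (lower j) ∈ u ⟧ *) ⇒ (k (lower j) *)))

  Assignment : Set (c ⊔ lsuc ℓ)
  Assignment = ℕ → V

  _[_↦_] : Assignment → ℕ → V → Assignment
  (ρ [ k ↦ x ]) n with n ≟ k
  ... | yes _ = x
  ... | no  _ = ρ n

  ⟦_⟧ : Formula → Assignment → Carrier
  ⟦ i ∈' j ⟧ ρ = ⟦ ρ i ∈ ρ j ⟧
  ⟦ i ≐' j ⟧ ρ = ⟦ ρ i ≐ ρ j ⟧
  ⟦ φ ⇒' ψ ⟧ ρ = ⟦ φ ⟧ ρ ⇒ ⟦ ψ ⟧ ρ
  ⟦ φ ∧' ψ ⟧ ρ = ⟦ φ ⟧ ρ ∧ ⟦ ψ ⟧ ρ
  ⟦ φ ∨' ψ ⟧ ρ = ⟦ φ ⟧ ρ ∨ ⟦ ψ ⟧ ρ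
  ⟦ ¬' φ ⟧ ρ = ⟦ φ ⟧ ρ *
  ⟦ ∀' k · φ ⟧ ρ = ⋀ {V} λ x → ⟦ φ ⟧ (ρ [ k ↦ x ])
  ⟦ ∃' k · φ ⟧ ρ = ⋁ {V} λ x → ⟦ φ ⟧ (ρ [ k ↦ x ])

  _⊨_ : Assignment → Formula → Set d
  ρ ⊨ φ = D (⟦ φ ⟧ ρ)

  _∼_ : V → V → Set d
  u ∼ v = D ⟦ u ≐ v ⟧

  -- V^(A)/∼ ⊨ φ([u⃗])  iff  V^(A) ⊨ φ(u⃗): the quotient satisfaction is
  -- defined through representatives; an assignment ρ of names represents
  -- the sequence of classes ([ρ 0], [ρ 1], …).
  _⊨/∼_ : Assignment → Formula → Set d
  ρ ⊨/∼ φ = ρ ⊨ φ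

{-# OPTIONS --safe #-}
-- If D is an ultrafilter of a Cobounded-algebra, then D is exactly the set
-- of nonzero elements: these form a proper filter (by coboundedness a meet
-- of two nonzero elements is nonzero) that contains D, as 𝟎 ∉ D.  Each
-- clause is then a statement about when a connective yields 𝟎: a ⇒ b = 𝟎
-- iff a ≠ 𝟎 and b = 𝟎, a meet is 𝟎 iff some argument is (coboundedness),
-- and a join is 𝟎 iff all arguments are.
module Submission where

open import Defs
open import Level using (Level; _⊔_; Lift; lift; lower) renaming (suc to lsuc)
open import Data.Nat using (ℕ)
open import Data.Bool using (true; false)
open import Data.Product using (_×_; ∃; _,_)
open import Data.Sum using (_⊎_; inj₁; inj₂; [_,_]′)
open import Function using (_∘_)
open import Relation.Nullary using (¬_)
open import Relation.Nullary.Decidable using (False; toWitnessFalse; fromWitnessFalse; decidable-stable)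
open import Relation.Binary.PropositionalEquality using (_≡_; _≢_; refl; sym; subst)
open import Function.Bundles using (_⇔_; mk⇔)
open import Axiom.ExcludedMiddle using (ExcludedMiddle)

module CoboundedAlgebraProperties {c ι : Level} (𝒜 : CoboundedAlgebra c ι) where
  open CoboundedAlgebra 𝒜

  x≤𝟎⇒x≡𝟎 : ∀ {x} → x ≤ 𝟎 → x ≡ 𝟎
  x≤𝟎⇒x≡𝟎 {x} x≤𝟎 = ≤-antisym x≤𝟎 (𝟎-bot x)

  x∧y≡𝟎⇒x≡𝟎⊎y≡𝟎 : ∀ x y → x ∧ y ≡ 𝟎 → x ≡ 𝟎 ⊎ y ≡ 𝟎
  x∧y≡𝟎⇒x≡𝟎⊎y≡𝟎 x y x∧y≡𝟎 with ⋀-cobounded pair ⋀pair≡𝟎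
    where
    pair : Lift ι _ → Carrier
    pair (lift true)  = x
    pair (lift false) = y

    ⋀pair≡𝟎 : ⋀ pair ≡ 𝟎
    ⋀pair≡𝟎 = x≤𝟎⇒x≡𝟎 (≤-trans (∧-glb (⋀-lb pair (lift true)) (⋀-lb pair (lift false)))
                                (subst (_ ≤_) x∧y≡𝟎 ≤-refl))
  ... | lift true  , x≡𝟎 = inj₁ x≡𝟎
  ... | lift false , y≡𝟎 = inj₂ y≡𝟎

  x≡𝟎⇒y≡𝟎⇒x∨y≡𝟎 : ∀ {x y} → x ≡ 𝟎 → y ≡ 𝟎 → x ∨ y ≡ 𝟎
  x≡𝟎⇒y≡𝟎⇒x∨y≡𝟎 refl refl = x≤𝟎⇒x≡𝟎 (∨-lub ≤-refl ≤-refl)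

  ∀≡𝟎⇒⋁≡𝟎 : ∀ {I : Set ι} (f : I → Carrier) → (∀ i → f i ≡ 𝟎) → ⋁ f ≡ 𝟎
  ∀≡𝟎⇒⋁≡𝟎 f fi≡𝟎 = x≤𝟎⇒x≡𝟎 (⋁-lub f λ i → subst (_≤ 𝟎) (sym (fi≡𝟎 i)) ≤-refl)

module DesignatedAlgebraProperties {c ι d : Level} (𝔸 : DesignatedAlgebra c ι d) where
  open DesignatedAlgebra 𝔸
  open CoboundedAlgebraProperties algebra

  D⇒≢𝟎 : ∀ {x} → D x → x ≢ 𝟎
  D⇒≢𝟎 Dx refl = D-𝟎 Dx

  ≡𝟏⇒D : ∀ {x} → x ≡ 𝟏 → D x
  ≡𝟏⇒D refl = D-𝟏

  D[x∧y]⇔Dx×Dy : ∀ x y → D (x ∧ y) ⇔ (D x × D y)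
  D[x∧y]⇔Dx×Dy x y = mk⇔ (λ Dx∧y → D-up (∧-lb₁ x y) Dx∧y , D-up (∧-lb₂ x y) Dx∧y)
                          (λ (Dx , Dy) → D-∧ Dx Dy)

  ¬Dx⇒D[x*] : ∀ x → ¬ D x → D (x *)
  ¬Dx⇒D[x*] x ¬Dx = ≡𝟏⇒D (*-¬D x ¬Dx)

  module Ultra (em : ∀ {p} → ExcludedMiddle p) (ultra : IsUltra) where

    -- IsUltra only speaks about filters valued in Set d, so "x ≢ 𝟎" (a
    -- proposition in Set c) is resized to Set d by deciding it.
    NonZero : Carrier → Set d
    NonZero x = Lift d (False (em {P = x ≡ 𝟎}))

    NonZero⇒≢𝟎 : ∀ {x} → NonZero x → x ≢ 𝟎
    NonZero⇒≢𝟎 = toWitnessFalse ∘ lower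

    ≢𝟎⇒NonZero : ∀ {x} → x ≢ 𝟎 → NonZero x
    ≢𝟎⇒NonZero = lift ∘ fromWitnessFalse

    nonZero-isProperFilter : IsProperFilter NonZero
    nonZero-isProperFilter = record
      { F-𝟏  = ≢𝟎⇒NonZero (D⇒≢𝟎 D-𝟏)
      ; F-𝟎  = λ NonZero𝟎 → NonZero⇒≢𝟎 NonZero𝟎 refl
      ; F-up = λ x≤y NonZero-x → ≢𝟎⇒NonZero λ y≡𝟎 →
                 NonZero⇒≢𝟎 NonZero-x (x≤𝟎⇒x≡𝟎 (subst (_ ≤_) y≡𝟎 x≤y))
      ; F-∧  = λ {x} {y} NonZero-x NonZero-y → ≢𝟎⇒NonZero
                 ([ NonZero⇒≢𝟎 NonZero-x , NonZero⇒≢𝟎 NonZero-y ]′ ∘ x∧y≡𝟎⇒x≡𝟎⊎y≡𝟎 x y)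
      }

    ≢𝟎⇒D : ∀ {x} → x ≢ 𝟎 → D x
    ≢𝟎⇒D {x} x≢𝟎 =
      ultra NonZero nonZero-isProperFilter (λ _ → ≢𝟎⇒NonZero ∘ D⇒≢𝟎) x (≢𝟎⇒NonZero x≢𝟎)

    ¬D⇒≡𝟎 : ∀ {x} → ¬ D x → x ≡ 𝟎
    ¬D⇒≡𝟎 ¬Dx = decidable-stable em (¬Dx ∘ ≢𝟎⇒D)

    D[x⇒y]⇔¬Dx⊎Dy : ∀ x y → D (x ⇒ y) ⇔ (¬ D x ⊎ D y)
    D[x⇒y]⇔¬Dx⊎Dy x y = mk⇔ to from
      where
      to : D (x ⇒ y) → ¬ D x ⊎ D y
      to Dx⇒y = decidable-stable em λ ¬[¬Dx⊎Dy] →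
        let Dx   = decidable-stable em (¬[¬Dx⊎Dy] ∘ inj₁)
            y≡𝟎 = ¬D⇒≡𝟎 (¬[¬Dx⊎Dy] ∘ inj₂)
        in D⇒≢𝟎 Dx⇒y (⇒-𝟎 x y (D⇒≢𝟎 Dx) y≡𝟎)

      from : ¬ D x ⊎ D y → D (x ⇒ y)
      from (inj₁ ¬Dx) = ≡𝟏⇒D (⇒-𝟏 x y λ (x≢𝟎 , _) → x≢𝟎 (¬D⇒≡𝟎 ¬Dx))
      from (inj₂ Dy)  = ≡𝟏⇒D (⇒-𝟏 x y λ (_ , y≡𝟎) → D⇒≢𝟎 Dy y≡𝟎)

    D[x∨y]⇔Dx⊎Dy : ∀ x y → D (x ∨ y) ⇔ (D x ⊎ D y)
    D[x∨y]⇔Dx⊎Dy x y = mk⇔ to [ D-up (∨-ub₁ x y) , D-up (∨-ub₂ x y) ]′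
      where
      to : D (x ∨ y) → D x ⊎ D y
      to Dx∨y = decidable-stable em λ ¬[Dx⊎Dy] →
        D⇒≢𝟎 Dx∨y (x≡𝟎⇒y≡𝟎⇒x∨y≡𝟎 (¬D⇒≡𝟎 (¬[Dx⊎Dy] ∘ inj₁)) (¬D⇒≡𝟎 (¬[Dx⊎Dy] ∘ inj₂)))

    D[⋀f]⇔∀Dfi : ∀ {I : Set ι} (f : I → Carrier) → D (⋀ f) ⇔ (∀ i → D (f i))
    D[⋀f]⇔∀Dfi f = mk⇔ (λ D⋀f i → D-up (⋀-lb f i) D⋀f) from
      where
      from : (∀ i → D (f i)) → D (⋀ f)
      from Dfi = ≢𝟎⇒D λ ⋀f≡𝟎 → let (j , fj≡𝟎) = ⋀-cobounded f ⋀f≡𝟎 in D⇒≢𝟎 (Dfi j) fj≡𝟎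

    D[⋁f]⇔∃Dfi : ∀ {I : Set ι} (f : I → Carrier) → D (⋁ f) ⇔ ∃ (λ i → D (f i))
    D[⋁f]⇔∃Dfi f = mk⇔ to (λ (i , Dfi) → D-up (⋁-ub f i) Dfi)
      where
      to : D (⋁ f) → ∃ (λ i → D (f i))
      to D⋁f = decidable-stable em λ ¬∃Dfi →
        D⇒≢𝟎 D⋁f (∀≡𝟎⇒⋁≡𝟎 f λ i → ¬D⇒≡𝟎 (¬∃Dfi ∘ (i ,_)))

mainTheorem12 :
  (em : ∀ {p} → ExcludedMiddle p) →
  ∀ {c d ℓ : Level} (𝔸 : DesignatedAlgebra c (c ⊔ lsuc ℓ) d) →
  DesignatedAlgebra.IsUltra 𝔸 →
  let open Semantics {c} {d} {ℓ} 𝔸 in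
  ∀ (φ ψ : Formula) (ρ : Assignment) →
    (ρ ⊨/∼ (φ ⇒' ψ) ⇔ (¬ (ρ ⊨/∼ φ) ⊎ ρ ⊨/∼ ψ))
  × (ρ ⊨/∼ (φ ∧' ψ) ⇔ (ρ ⊨/∼ φ × ρ ⊨/∼ ψ))
  × (ρ ⊨/∼ (φ ∨' ψ) ⇔ (ρ ⊨/∼ φ ⊎ ρ ⊨/∼ ψ))
  × (¬ (ρ ⊨/∼ φ) → ρ ⊨/∼ (¬' φ))
  × (∀ (k : ℕ) → ρ ⊨/∼ (∀' k · φ) ⇔ (∀ (x : V) → (ρ [ k ↦ x ]) ⊨/∼ φ))
  × (∀ (k : ℕ) → ρ ⊨/∼ (∃' k · φ) ⇔ ∃ λ (x : V) → (ρ [ k ↦ x ]) ⊨/∼ φ)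
mainTheorem12 em {c} {d} {ℓ} 𝔸 ultra φ ψ ρ =
    D[x⇒y]⇔¬Dx⊎Dy (⟦ φ ⟧ ρ) (⟦ ψ ⟧ ρ)
  , D[x∧y]⇔Dx×Dy (⟦ φ ⟧ ρ) (⟦ ψ ⟧ ρ)
  , D[x∨y]⇔Dx⊎Dy (⟦ φ ⟧ ρ) (⟦ ψ ⟧ ρ)
  , ¬Dx⇒D[x*] (⟦ φ ⟧ ρ)
  , (λ k → D[⋀f]⇔∀Dfi (λ x → ⟦ φ ⟧ (ρ [ k ↦ x ])))
  , (λ k → D[⋁f]⇔∃Dfi (λ x → ⟦ φ ⟧ (ρ [ k ↦ x ])))
  where
  open Semantics {c} {d} {ℓ} 𝔸
  open DesignatedAlgebraProperties 𝔸
  open Ultra em ultra
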